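{- For every even positive integer $m$ there exists a normalized monotone set function $f$ over $[m]$ with $\mathrm{SMW}(f)=1$ and $\mathrm{SAW}(f)=m/2$.
   Context: A set function $f:2^{[m]}\to\mathbb{R}$ is normalized if $f(\emptyset)=0$ and monotone if $f(S)\le f(T)$ for $S\subseteq T$. Write $f(S\mid T)=f(S\cup T)-f(T)$, $f(v\mid T)=f(\{v\}\mid T)$. A set $T$ is supermodular w.r.t. $f$ if there exist $S\subseteq[m]$ and $v\in[m]\setminus T$ with $f(v\mid S\cup T)>\max_{T'\subsetneq T} f(v\mid S\cup T')$; $\mathrm{SMW}(f)$ is the maximum cardinality of a nonempty supermodular set (0 if none). A set $T$ is superadditive w.r.t. $f$ if there exists $S\subseteq[m]\setminus T$ with $f(S\mid T)>\max_{T'\subsetneq T} f(S\mid T')$; $\mathrm{SAW}(f)$ is the maximum cardinality of a nonempty superadditive set (0 if none). -}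

module Defs where

open import Data.Nat using (ℕ; _≤_)
open import Data.Fin using (Fin)
open import Data.Fin.Subset using (Subset; ⊥; ⁅_⁆; _∈_; _∉_; _⊆_; _⊂_; _∪_; ∣_∣; Nonempty)
open import Data.Rational using (ℚ; 0ℚ; _-_) renaming (_<_ to _<ℚ_; _≤_ to _≤ℚ_)
open import Data.Product using (Σ; _×_)
open import Data.Sum using (_⊎_)
open import Relation.Binary.PropositionalEquality using (_≡_)
open import Relation.Nullary using (¬_)

SetFn : ℕ → Set
SetFn m = Subset m → ℚ

module _ {m : ℕ} (f : SetFn m) where

  Normalized : Set
  Normalized = f ⊥ ≡ 0ℚ

  Monotone : Set
  Monotone = ∀ (S T : Subset m) → S ⊆ T → f S ≤ℚ f T

  marg : Subset m → Subset m → ℚ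
  marg S T = f (S ∪ T) - f T

  margᵥ : Fin m → Subset m → ℚ
  margᵥ v T = marg ⁅ v ⁆ T

  -- T is supermodular w.r.t. f: ∃ S, v ∉ T with
  -- f(v | S ∪ T) > max_{T' ⊊ T} f(v | S ∪ T')
  -- (max over the finite set of proper subsets, written out as
  --  "strictly greater than every member"; for nonempty T this set is nonempty)
  SupermodularSet : Subset m → Set
  SupermodularSet T =
    Σ (Subset m) λ S → Σ (Fin m) λ v → v ∉ T ×
      (∀ (T' : Subset m) → T' ⊂ T → margᵥ v (S ∪ T') <ℚ margᵥ v (S ∪ T))

  SuperadditiveSet : Subset m → Set
  SuperadditiveSet T =
    Σ (Subset m) λ S → (∀ {x} → x ∈ S → x ∉ T) ×
      (∀ (T' : Subset m) → T' ⊂ T → marg S T' <ℚ marg S T)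

-- "the maximum cardinality of a nonempty set satisfying P is k (0 if none)"
MaxWidth : {m : ℕ} → (Subset m → Set) → ℕ → Set
MaxWidth {m} P k =
  (∀ (T : Subset m) → Nonempty T → P T → ∣ T ∣ ≤ k) ×
  ((k ≡ 0) ⊎ Σ (Subset m) λ T → Nonempty T × P T × ∣ T ∣ ≡ k)

SMW≡ : {m : ℕ} → SetFn m → ℕ → Set
SMW≡ f k = MaxWidth (SupermodularSet f) k

SAW≡ : {m : ℕ} → SetFn m → ℕ → Set
SAW≡ f k = MaxWidth (SuperadditiveSet f) k

-- Group [m] into the pairs {0,1}, {2,3}, ... and let f(S) count the pairs contained in S.
-- The marginal value of v only depends on whether the partner of v is present, so a
-- supermodular set must consist of that partner alone and SMW(f) = 1; for the same reason a
-- proper subset T' of T loses nothing against S unless T meets every pair in one element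
-- whose partner lies in S, whence SAW(f) ≤ m/2.  Taking T to be the first elements of the
-- pairs and S the second elements attains m/2.
module Submission where

open import Defs
open import Data.Nat using (ℕ; _*_; _<_)
open import Data.Product using (Σ; _×_)
open import Relation.Binary.PropositionalEquality using (_≡_)

open import Algebra.Properties.CommutativeSemigroup as CommSemigroupProperties using ()
open import Data.Bool using (Bool; true; false; _∨_)
open import Data.Fin using (Fin; zero; suc)
open import Data.Fin.Subset using (Subset; ⊥; ⁅_⁆; _∈_; _∉_; _⊆_; _⊂_; _∪_; ∣_∣)
open import Data.Fin.Subset.Properties
  using (drop-∷-⊆; out⊂; out⊂in; s⊂s; ∪-identityˡ; p⊂q⇒∣p∣<∣q∣; x∈⁅y⁆⇒x≡y; ∣⁅x⁆∣≡1; ⊆-refl)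
open import Data.Nat using (zero; suc; _+_; _≤_; _≤?_; z≤n; s≤s; z<s; ⌊_/2⌋)
open import Data.Nat.Properties as ℕ
  using (+-comm; +-identityʳ; +-mono-≤; +-mono-<-≤; m≤n⇒m≤1+n; m≤n⇒m≤o+n; n≡⌊n+n/2⌋; *-monoʳ-≤)
open import Data.Product using (_,_)
open import Data.Rational as ℚ using (ℚ)
import Data.Rational.Properties as ℚ
open import Data.Rational.Solver using (module +-*-Solver)
open import Data.Sum as Sum using (_⊎_; inj₁; inj₂)
open import Data.Vec using ([]; _∷_; here; there)
open import Relation.Binary.PropositionalEquality
  using (refl; sym; trans; cong; cong₂; subst; subst₂; module ≡-Reasoning)
open import Relation.Nullary using (yes; no; contradiction)

fromℕ : ℕ → ℚ
fromℕ zero    = ℚ.0ℚ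
fromℕ (suc n) = ℚ.1ℚ ℚ.+ fromℕ n

fromℕ-+ : ∀ a b → fromℕ (a + b) ≡ fromℕ a ℚ.+ fromℕ b
fromℕ-+ zero    b = sym (ℚ.+-identityˡ (fromℕ b))
fromℕ-+ (suc a) b =
  trans (cong (ℚ.1ℚ ℚ.+_) (fromℕ-+ a b)) (sym (ℚ.+-assoc ℚ.1ℚ (fromℕ a) (fromℕ b)))

fromℕ-nonNeg : ∀ n → ℚ.0ℚ ℚ.≤ fromℕ n
fromℕ-nonNeg zero    = ℚ.≤-refl
fromℕ-nonNeg (suc n) = ℚ.+-mono-≤ (ℚ.<⇒≤ (ℚ.positive⁻¹ ℚ.1ℚ)) (fromℕ-nonNeg n)

fromℕ-mono-≤ : ∀ {a b} → a ≤ b → fromℕ a ℚ.≤ fromℕ b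
fromℕ-mono-≤ {zero}  {b}     _       = fromℕ-nonNeg b
fromℕ-mono-≤ {suc a} {suc b} (s≤s p) = ℚ.+-monoʳ-≤ ℚ.1ℚ (fromℕ-mono-≤ p)

fromℕ-mono-< : ∀ {a b} → a < b → fromℕ a ℚ.< fromℕ b
fromℕ-mono-< {zero}  {suc b} _       = ℚ.+-mono-<-≤ (ℚ.positive⁻¹ ℚ.1ℚ) (fromℕ-nonNeg b)
fromℕ-mono-< {suc a} {suc b} (s≤s p) = ℚ.+-monoʳ-< ℚ.1ℚ (fromℕ-mono-< p)

[x+z]-[y+z]≡x-y : ∀ x y z → (x ℚ.+ z) ℚ.- (y ℚ.+ z) ≡ x ℚ.- y
[x+z]-[y+z]≡x-y = solve 3 (λ x y z → (x :+ z) :- (y :+ z) := x :- y) refl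
  where open +-*-Solver

+≡+⇒-≡- : ∀ p q r s → p ℚ.+ s ≡ r ℚ.+ q → p ℚ.- q ≡ r ℚ.- s
+≡+⇒-≡- p q r s eq = begin
  p ℚ.- q                   ≡⟨ sym ([x+z]-[y+z]≡x-y p q s) ⟩
  (p ℚ.+ s) ℚ.- (q ℚ.+ s)   ≡⟨ cong₂ ℚ._-_ eq (ℚ.+-comm q s) ⟩
  (r ℚ.+ q) ℚ.- (s ℚ.+ q)   ≡⟨ [x+z]-[y+z]≡x-y r s q ⟩
  r ℚ.- s                   ∎
  where open ≡-Reasoning

+<+⇒-<- : ∀ p q r s → p ℚ.+ s ℚ.< r ℚ.+ q → p ℚ.- q ℚ.< r ℚ.- s
+<+⇒-<- p q r s lt = begin-strict
  p ℚ.- q                   ≡⟨ sym ([x+z]-[y+z]≡x-y p q s) ⟩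
  (p ℚ.+ s) ℚ.- (q ℚ.+ s)   <⟨ ℚ.+-monoˡ-< (ℚ.- (q ℚ.+ s)) lt ⟩
  (r ℚ.+ q) ℚ.- (q ℚ.+ s)   ≡⟨ cong (λ t → (r ℚ.+ q) ℚ.- t) (ℚ.+-comm q s) ⟩
  (r ℚ.+ q) ℚ.- (s ℚ.+ q)   ≡⟨ [x+z]-[y+z]≡x-y r s q ⟩
  r ℚ.- s                   ∎
  where open ℚ.≤-Reasoning

both : Bool → Bool → ℕ
both true true = 1
both _    _    = 0

-- An odd last element belongs to no pair.
pairs : ∀ {n} → Subset n → ℕ
pairs []          = 0
pairs (_ ∷ [])    = 0
pairs (x ∷ y ∷ S) = both x y + pairs S

pairFn : ∀ {n} → SetFn n
pairFn S = fromℕ (pairs S)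

pairs-⊥ : ∀ n → pairs (⊥ {n}) ≡ 0
pairs-⊥ zero          = refl
pairs-⊥ (suc zero)    = refl
pairs-⊥ (suc (suc n)) = pairs-⊥ n

drop-∷∷-⊆ : ∀ {n} {a b u v} {S T : Subset n} → a ∷ b ∷ S ⊆ u ∷ v ∷ T → S ⊆ T
drop-∷∷-⊆ S⊆T = drop-∷-⊆ (drop-∷-⊆ S⊆T)

pairs-mono : ∀ {n} {S T : Subset n} → S ⊆ T → pairs S ≤ pairs T
pairs-mono {S = []}               {[]}         _   = z≤n
pairs-mono {S = _ ∷ []}           {_ ∷ []}     _   = z≤n
pairs-mono {S = true ∷ true ∷ S}  {_ ∷ _ ∷ T}  S⊆T with S⊆T here | S⊆T (there here)
... | here | there here = +-mono-≤ ℕ.≤-refl (pairs-mono (drop-∷∷-⊆ S⊆T))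
pairs-mono {S = true ∷ false ∷ S} {u ∷ v ∷ T}  S⊆T = m≤n⇒m≤o+n (both u v) (pairs-mono (drop-∷∷-⊆ S⊆T))
pairs-mono {S = false ∷ _ ∷ S}    {u ∷ v ∷ T}  S⊆T = m≤n⇒m≤o+n (both u v) (pairs-mono (drop-∷∷-⊆ S⊆T))

pairFn-normalized : ∀ n → Normalized (pairFn {n})
pairFn-normalized n = cong fromℕ (pairs-⊥ n)

pairFn-monotone : ∀ {n} → Monotone (pairFn {n})
pairFn-monotone S T S⊆T = fromℕ-mono-≤ (pairs-mono S⊆T)

-- The gain pairs (S ∪ T′) − pairs T′ is equal to, resp. below, pairs (S ∪ T) − pairs T;
-- stated with both subtrahends moved across so that no truncated subtraction occurs.
-- Records rather than synonyms, so that S, T′ and T can be inferred from the type.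
record Gain≡ {n} (S T′ T : Subset n) : Set where
  constructor gain≡
  field cross : pairs (S ∪ T′) + pairs T ≡ pairs (S ∪ T) + pairs T′

record Gain< {n} (S T′ T : Subset n) : Set where
  constructor gain<
  field cross : pairs (S ∪ T′) + pairs T < pairs (S ∪ T) + pairs T′

gain≡⇒marg≡ : ∀ {n} {S T′ T : Subset n} → Gain≡ S T′ T → marg pairFn S T′ ≡ marg pairFn S T
gain≡⇒marg≡ {S = S} {T′} {T} (gain≡ eq) =
  +≡+⇒-≡- (pairFn (S ∪ T′)) (pairFn T′) (pairFn (S ∪ T)) (pairFn T) (begin
  pairFn (S ∪ T′) ℚ.+ pairFn T         ≡⟨ fromℕ-+ (pairs (S ∪ T′)) (pairs T) ⟨
  fromℕ (pairs (S ∪ T′) + pairs T)     ≡⟨ cong fromℕ eq ⟩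
  fromℕ (pairs (S ∪ T) + pairs T′)     ≡⟨ fromℕ-+ (pairs (S ∪ T)) (pairs T′) ⟩
  pairFn (S ∪ T) ℚ.+ pairFn T′         ∎)
  where open ≡-Reasoning

gain<⇒marg< : ∀ {n} {S T′ T : Subset n} → Gain< S T′ T → marg pairFn S T′ ℚ.< marg pairFn S T
gain<⇒marg< {S = S} {T′} {T} (gain< lt) =
  +<+⇒-<- (pairFn (S ∪ T′)) (pairFn T′) (pairFn (S ∪ T)) (pairFn T)
    (subst₂ ℚ._<_ (fromℕ-+ (pairs (S ∪ T′)) (pairs T)) (fromℕ-+ (pairs (S ∪ T)) (pairs T′))
      (fromℕ-mono-< lt))

gain≡-⊥ : ∀ {n} (T′ T : Subset n) → Gain≡ ⊥ T′ T
gain≡-⊥ T′ T = gain≡ cross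
  where
  cross : pairs (⊥ ∪ T′) + pairs T ≡ pairs (⊥ ∪ T) + pairs T′
  cross rewrite ∪-identityˡ T′ | ∪-identityˡ T = +-comm (pairs T′) (pairs T)

module _ (a c : ℕ) {b d x y z w : ℕ} where

  private
    interchange : ∀ p q r s → (p + q) + (r + s) ≡ (p + r) + (q + s)
    interchange = CommSemigroupProperties.interchange ℕ.+-commutativeSemigroup

  +-interchange-≡ : a + b ≡ c + d → x + y ≡ z + w → (a + x) + (b + y) ≡ (c + z) + (d + w)
  +-interchange-≡ ab≡cd xy≡zw = begin
    (a + x) + (b + y)   ≡⟨ interchange a x b y ⟩
    (a + b) + (x + y)   ≡⟨ cong₂ _+_ ab≡cd xy≡zw ⟩
    (c + d) + (z + w)   ≡⟨ interchange c d z w ⟩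
    (c + z) + (d + w)   ∎
    where open ≡-Reasoning

  +-interchange-< : a + b < c + d → x + y ≡ z + w → (a + x) + (b + y) < (c + z) + (d + w)
  +-interchange-< ab<cd xy≡zw = begin-strict
    (a + x) + (b + y)   ≡⟨ interchange a x b y ⟩
    (a + b) + (x + y)   <⟨ +-mono-<-≤ ab<cd (ℕ.≤-reflexive xy≡zw) ⟩
    (c + d) + (z + w)   ≡⟨ interchange c d z w ⟩
    (c + z) + (d + w)   ∎
    where open ℕ.≤-Reasoning

module _ {n} {a b u′ v′ u v : Bool} {S T′ T : Subset n} where

  gain≡-∷∷ : both (a ∨ u′) (b ∨ v′) + both u v ≡ both (a ∨ u) (b ∨ v) + both u′ v′ →
             Gain≡ S T′ T → Gain≡ (a ∷ b ∷ S) (u′ ∷ v′ ∷ T′) (u ∷ v ∷ T)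
  gain≡-∷∷ head (gain≡ tail) = gain≡
    (+-interchange-≡ (both (a ∨ u′) (b ∨ v′)) (both (a ∨ u) (b ∨ v)) head tail)

  gain<-∷∷ : both (a ∨ u′) (b ∨ v′) + both u v < both (a ∨ u) (b ∨ v) + both u′ v′ →
             Gain≡ S T′ T → Gain< (a ∷ b ∷ S) (u′ ∷ v′ ∷ T′) (u ∷ v ∷ T)
  gain<-∷∷ head (gain≡ tail) = gain<
    (+-interchange-< (both (a ∨ u′) (b ∨ v′)) (both (a ∨ u) (b ∨ v)) head tail)

∃⊂ : ∀ {n} (T : Subset n) → 0 < ∣ T ∣ → Σ (Subset n) (_⊂ T)
∃⊂ (true ∷ T)  _ = false ∷ T , out⊂in ⊆-refl
∃⊂ (false ∷ T) p with ∃⊂ T p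
... | T′ , T′⊂T = false ∷ T′ , out⊂ T′⊂T

2≤∣x∷p∣⇒0<∣p∣ : ∀ {n} (x : Bool) (p : Subset n) → 2 ≤ ∣ x ∷ p ∣ → 0 < ∣ p ∣
2≤∣x∷p∣⇒0<∣p∣ true  p (s≤s 1≤∣p∣) = 1≤∣p∣
2≤∣x∷p∣⇒0<∣p∣ false p 2≤∣p∣       = ℕ.≤-trans (s≤s z≤n) 2≤∣p∣

-- The gain of v only depends on the pair of v, so a second element of T outside v's pair
-- can be dropped.
marginal-reducible : ∀ {n} (v : Fin n) (S T : Subset n) → v ∉ T → 2 ≤ ∣ T ∣ →
  Σ (Subset n) λ T′ → T′ ⊂ T × Gain≡ ⁅ v ⁆ (S ∪ T′) (S ∪ T)
marginal-reducible zero S (true ∷ T) v∉T _ = contradiction here v∉T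
marginal-reducible zero (s₀ ∷ s₁ ∷ S) (false ∷ t₁ ∷ T) _ 2≤∣T∣
  with ∃⊂ T (2≤∣x∷p∣⇒0<∣p∣ t₁ T 2≤∣T∣)
... | T′ , T′⊂T = false ∷ t₁ ∷ T′ , s⊂s (s⊂s T′⊂T) , gain≡-∷∷ refl (gain≡-⊥ (S ∪ T′) (S ∪ T))
marginal-reducible (suc zero) S (t₀ ∷ true ∷ T) v∉T _ = contradiction (there here) v∉T
marginal-reducible (suc zero) (s₀ ∷ s₁ ∷ S) (t₀ ∷ false ∷ T) _ 2≤∣T∣
  with ∃⊂ T (2≤∣x∷p∣⇒0<∣p∣ t₀ (false ∷ T) 2≤∣T∣)
... | T′ , T′⊂T = t₀ ∷ false ∷ T′ , s⊂s (s⊂s T′⊂T) , gain≡-∷∷ refl (gain≡-⊥ (S ∪ T′) (S ∪ T))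
marginal-reducible (suc (suc v)) (s₀ ∷ s₁ ∷ S) (true ∷ t₁ ∷ T) _ _ =
  false ∷ t₁ ∷ T , out⊂in ⊆-refl ,
  gain≡-∷∷ (+-comm (both (s₀ ∨ false) (s₁ ∨ t₁)) (both (s₀ ∨ true) (s₁ ∨ t₁))) (gain≡ refl)
marginal-reducible (suc (suc v)) (s₀ ∷ s₁ ∷ S) (false ∷ true ∷ T) _ _ =
  false ∷ false ∷ T , s⊂s (out⊂in ⊆-refl) ,
  gain≡-∷∷ (+-comm (both (s₀ ∨ false) (s₁ ∨ false)) (both (s₀ ∨ false) (s₁ ∨ true))) (gain≡ refl)
marginal-reducible (suc (suc v)) (s₀ ∷ s₁ ∷ S) (false ∷ false ∷ T) v∉T 2≤∣T∣
  with marginal-reducible v S T (λ v∈T → v∉T (there (there v∈T))) 2≤∣T∣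
... | T′ , T′⊂T , sameGain = false ∷ false ∷ T′ , s⊂s (s⊂s T′⊂T) , gain≡-∷∷ refl sameGain

supermodular-∣∣≤1 : ∀ {n} (T : Subset n) → SupermodularSet pairFn T → ∣ T ∣ ≤ 1
supermodular-∣∣≤1 T (S , v , v∉T , increases) with 2 ≤? ∣ T ∣
... | no  2≰∣T∣ = ℕ.≤-pred (ℕ.≰⇒> 2≰∣T∣)
... | yes 2≤∣T∣ with marginal-reducible v S T v∉T 2≤∣T∣
...   | T′ , T′⊂T , sameGain = contradiction (gain≡⇒marg≡ sameGain) (ℚ.<⇒≢ (increases T′ T′⊂T))

Disjoint : ∀ {n} → Subset n → Subset n → Set
Disjoint S T = ∀ {x} → x ∈ S → x ∉ T

drop-∷∷-Disjoint : ∀ {n} {a b u v} {S T : Subset n} →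
                   Disjoint (a ∷ b ∷ S) (u ∷ v ∷ T) → Disjoint S T
drop-∷∷-Disjoint S∩T=∅ x∈S x∈T = S∩T=∅ (there (there x∈S)) (there (there x∈T))

Reducible : ∀ {n} → Subset n → Subset n → Set
Reducible {n} S T = Σ (Subset n) λ T′ → T′ ⊂ T × Gain≡ S T′ T

reducible-∷∷ : ∀ {n} {a b u v} {S T : Subset n} → Reducible S T → Reducible (a ∷ b ∷ S) (u ∷ v ∷ T)
reducible-∷∷ {u = u} {v} (T′ , T′⊂T , sameGain) =
  u ∷ v ∷ T′ , s⊂s (s⊂s T′⊂T) , gain≡-∷∷ refl sameGain

-- Dropping an element of T whose partner is not in S does not change the gain of S, so
-- unless T picks one element from distinct pairs, always with its partner in S, some proper
-- subset of T gains as much as T.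
reducible-or-∣∣≤⌊n/2⌋ : ∀ {n} (S T : Subset n) → Disjoint S T → Reducible S T ⊎ ∣ T ∣ ≤ ⌊ n /2⌋
reducible-or-∣∣≤⌊n/2⌋ [] [] _ = inj₂ z≤n
reducible-or-∣∣≤⌊n/2⌋ (_ ∷ []) (false ∷ []) _ = inj₂ z≤n
reducible-or-∣∣≤⌊n/2⌋ (_ ∷ []) (true ∷ []) _ = inj₁ (false ∷ [] , out⊂in ⊆-refl , gain≡ refl)
reducible-or-∣∣≤⌊n/2⌋ (_ ∷ _ ∷ S) (false ∷ false ∷ T) S∩T=∅ =
  Sum.map reducible-∷∷ m≤n⇒m≤1+n (reducible-or-∣∣≤⌊n/2⌋ S T (drop-∷∷-Disjoint S∩T=∅))
reducible-or-∣∣≤⌊n/2⌋ (false ∷ true ∷ S) (true ∷ false ∷ T) S∩T=∅ =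
  Sum.map reducible-∷∷ s≤s (reducible-or-∣∣≤⌊n/2⌋ S T (drop-∷∷-Disjoint S∩T=∅))
reducible-or-∣∣≤⌊n/2⌋ (true ∷ false ∷ S) (false ∷ true ∷ T) S∩T=∅ =
  Sum.map reducible-∷∷ s≤s (reducible-or-∣∣≤⌊n/2⌋ S T (drop-∷∷-Disjoint S∩T=∅))
reducible-or-∣∣≤⌊n/2⌋ (true ∷ _ ∷ S) (true ∷ _ ∷ T) S∩T=∅ = contradiction here (S∩T=∅ here)
reducible-or-∣∣≤⌊n/2⌋ (_ ∷ true ∷ S) (_ ∷ true ∷ T) S∩T=∅ =
  contradiction (there here) (S∩T=∅ (there here))
reducible-or-∣∣≤⌊n/2⌋ (false ∷ false ∷ S) (true ∷ t₁ ∷ T) _ =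
  inj₁ (false ∷ t₁ ∷ T , out⊂in ⊆-refl , gain≡-∷∷ (sym (+-identityʳ (both true t₁))) (gain≡ refl))
reducible-or-∣∣≤⌊n/2⌋ (false ∷ false ∷ S) (false ∷ true ∷ T) _ =
  inj₁ (false ∷ false ∷ T , s⊂s (out⊂in ⊆-refl) , gain≡-∷∷ refl (gain≡ refl))

superadditive-∣∣≤⌊n/2⌋ : ∀ {n} (T : Subset n) → SuperadditiveSet pairFn T → ∣ T ∣ ≤ ⌊ n /2⌋
superadditive-∣∣≤⌊n/2⌋ T (S , S∩T=∅ , increases) with reducible-or-∣∣≤⌊n/2⌋ S T S∩T=∅
... | inj₂ ∣T∣≤⌊n/2⌋              = ∣T∣≤⌊n/2⌋
... | inj₁ (T′ , T′⊂T , sameGain) = contradiction (gain≡⇒marg≡ sameGain) (ℚ.<⇒≢ (increases T′ T′⊂T))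

⊂⁅x⁆⇒x∉ : ∀ {n} {x : Fin n} {T : Subset n} → T ⊂ ⁅ x ⁆ → x ∉ T
⊂⁅x⁆⇒x∉ (_ , y , y∈⁅x⁆ , y∉T) x∈T rewrite x∈⁅y⁆⇒x≡y _ y∈⁅x⁆ = y∉T x∈T

⁅0⁆-supermodular : ∀ {n} → SupermodularSet (pairFn {suc (suc n)}) ⁅ zero ⁆
⁅0⁆-supermodular = ⊥ , suc zero , (λ { (there ()) }) , λ T′ T′⊂⁅0⁆ → gain<⇒marg< (gain T′ T′⊂⁅0⁆)
  where
  gain : ∀ {n} (T′ : Subset (suc (suc n))) → T′ ⊂ ⁅ zero ⁆ →
         Gain< ⁅ suc zero ⁆ (⊥ ∪ T′) (⊥ ∪ ⁅ zero ⁆)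
  gain (true  ∷ _  ∷ _) T′⊂⁅0⁆ = contradiction here (⊂⁅x⁆⇒x∉ T′⊂⁅0⁆)
  gain (false ∷ t₁ ∷ T) _      = gain<-∷∷ z<s (gain≡-⊥ (⊥ ∪ T) (⊥ ∪ ⊥))

firsts seconds : ∀ n → Subset n
firsts zero          = []
firsts (suc zero)    = false ∷ []
firsts (suc (suc n)) = true ∷ false ∷ firsts n
seconds zero          = []
seconds (suc zero)    = false ∷ []
seconds (suc (suc n)) = false ∷ true ∷ seconds n

∣firsts∣≡⌊n/2⌋ : ∀ n → ∣ firsts n ∣ ≡ ⌊ n /2⌋
∣firsts∣≡⌊n/2⌋ zero          = refl
∣firsts∣≡⌊n/2⌋ (suc zero)    = refl
∣firsts∣≡⌊n/2⌋ (suc (suc n)) = cong suc (∣firsts∣≡⌊n/2⌋ n)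

seconds-disjoint-firsts : ∀ n → Disjoint (seconds n) (firsts n)
seconds-disjoint-firsts (suc zero)    (there ())
seconds-disjoint-firsts (suc (suc n)) (there here) (there ())
seconds-disjoint-firsts (suc (suc n)) (there (there x∈S)) (there (there x∈T)) =
  seconds-disjoint-firsts n x∈S x∈T

pairs-⊆firsts : ∀ {n} (T : Subset n) → T ⊆ firsts n → pairs T ≡ 0
pairs-⊆firsts []                 _ = refl
pairs-⊆firsts (_ ∷ [])           _ = refl
pairs-⊆firsts (_ ∷ true ∷ T)     T⊆ with T⊆ (there here)
... | there ()
pairs-⊆firsts (true ∷ false ∷ T)  T⊆ = pairs-⊆firsts T (drop-∷∷-⊆ T⊆)
pairs-⊆firsts (false ∷ false ∷ T) T⊆ = pairs-⊆firsts T (drop-∷∷-⊆ T⊆)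

pairs-seconds∪⊆firsts : ∀ {n} (T : Subset n) → T ⊆ firsts n → pairs (seconds n ∪ T) ≡ ∣ T ∣
pairs-seconds∪⊆firsts []                 _ = refl
pairs-seconds∪⊆firsts (false ∷ [])       _ = refl
pairs-seconds∪⊆firsts (true ∷ [])        T⊆ with T⊆ here
... | ()
pairs-seconds∪⊆firsts (_ ∷ true ∷ T)     T⊆ with T⊆ (there here)
... | there ()
pairs-seconds∪⊆firsts (true ∷ false ∷ T)  T⊆ = cong suc (pairs-seconds∪⊆firsts T (drop-∷∷-⊆ T⊆))
pairs-seconds∪⊆firsts (false ∷ false ∷ T) T⊆ = pairs-seconds∪⊆firsts T (drop-∷∷-⊆ T⊆)

firsts-superadditive : ∀ n → SuperadditiveSet pairFn (firsts n)
firsts-superadditive n = seconds n , seconds-disjoint-firsts n , λ T′ T′⊂ → gain<⇒marg< (gain T′ T′⊂)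
  where
  gain : ∀ T′ → T′ ⊂ firsts n → Gain< (seconds n) T′ (firsts n)
  gain T′ T′⊂@(T′⊆ , _) = gain< (begin-strict
    pairs (seconds n ∪ T′) + pairs (firsts n)
      ≡⟨ cong₂ _+_ (pairs-seconds∪⊆firsts T′ T′⊆) (pairs-⊆firsts (firsts n) ⊆-refl) ⟩
    ∣ T′ ∣ + 0
      <⟨ ℕ.+-monoˡ-< 0 (p⊂q⇒∣p∣<∣q∣ T′⊂) ⟩
    ∣ firsts n ∣ + 0
      ≡⟨ cong₂ _+_ (pairs-seconds∪⊆firsts (firsts n) ⊆-refl) (pairs-⊆firsts T′ T′⊆) ⟨
    pairs (seconds n ∪ firsts n) + pairs T′     ∎)
    where open ℕ.≤-Reasoning

SMW≡-pairFn : ∀ {n} → 2 ≤ n → SMW≡ (pairFn {n}) 1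
SMW≡-pairFn {n} (s≤s (s≤s _)) =
  (λ T _ → supermodular-∣∣≤1 T) ,
  inj₂ (⁅ zero ⁆ , (zero , here) , ⁅0⁆-supermodular , ∣⁅x⁆∣≡1 {n} zero)

SAW≡-pairFn : ∀ {n} → 2 ≤ n → SAW≡ (pairFn {n}) ⌊ n /2⌋
SAW≡-pairFn {n} (s≤s (s≤s _)) =
  (λ T _ → superadditive-∣∣≤⌊n/2⌋ T) ,
  inj₂ (firsts n , (zero , here) , firsts-superadditive n , ∣firsts∣≡⌊n/2⌋ n)

⌊2*n/2⌋≡n : ∀ n → ⌊ 2 * n /2⌋ ≡ n
⌊2*n/2⌋≡n n = trans (cong (λ m → ⌊ n + m /2⌋) (+-identityʳ n)) (sym (n≡⌊n+n/2⌋ n))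

0<2*n⇒2≤2*n : ∀ n → 0 < 2 * n → 2 ≤ 2 * n
0<2*n⇒2≤2*n (suc n) _ = *-monoʳ-≤ 2 (s≤s z≤n)

proposition4 : ∀ (m k : ℕ) → m ≡ 2 * k → 0 < m →
    Σ (SetFn m) λ f → Normalized f × Monotone f × SMW≡ f 1 × SAW≡ f k
proposition4 _ k refl 0<m =
  pairFn , pairFn-normalized (2 * k) , pairFn-monotone ,
  SMW≡-pairFn 2≤m , subst (SAW≡ pairFn) (⌊2*n/2⌋≡n k) (SAW≡-pairFn 2≤m)
  where
  2≤m : 2 ≤ 2 * k
  2≤m = 0<2*n⇒2≤2*n k 0<m
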